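{- The Thue–Morse word $t$ has no privileged factor of length $n$ for any odd $n\ge 5$.
   Context: The Thue–Morse word $t$ is the fixed point starting with $0$ of the morphism $0\mapsto 01$, $1\mapsto 10$, i.e. $t=\lim_{n\to\infty}\varphi^n(0)$. A complete first return to $u$ is a word that starts with $u$, ends with $u$, and contains exactly two occurrences of $u$. Privileged words are defined recursively: the empty word is privileged; every letter is privileged; a word of length at least $2$ is privileged if it is a complete first return to a shorter privileged word. -}

module Defs where

open import Data.Bool using (Bool; true; false; not; if_then_else_)
open import Data.Nat using (ℕ; zero; suc; _+_; _<_; _≤_; _∸_)
open import Data.List using (List; []; _∷_; _++_; length; take; drop; concatMap; lookup)
open import Data.Product using (Σ; _×_; ∃)
open import Relation.Binary.PropositionalEquality using (_≡_)

-- Binary alphabet: letter 0 is false, letter 1 is true.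
Word : Set
Word = List Bool

φ₁ : Bool → Word
φ₁ false = false ∷ true ∷ []
φ₁ true  = true ∷ false ∷ []

φ : Word → Word
φ = concatMap φ₁

φ^ : ℕ → Word → Word
φ^ zero    w = w
φ^ (suc k) w = φ (φ^ k w)

-- i-th letter of a word, with a default for out-of-range indices.
at : Word → ℕ → Bool
at []      _       = false
at (a ∷ w) zero    = a
at (a ∷ w) (suc i) = at w i

-- The Thue–Morse word t = lim φⁿ(0), as a function ℕ → Bool:
-- t(i) is the i-th letter of φ^(i+1)(0), which has length 2^(i+1) > i and
-- is a prefix of t (φ^k(0) is a prefix of φ^(k+1)(0)).
thueMorse : ℕ → Bool
thueMorse i = at (φ^ (suc i) (false ∷ [])) i

factorAt : ℕ → ℕ → Word
factorAt i zero    = []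
factorAt i (suc n) = thueMorse i ∷ factorAt (suc i) n

IsFactorOfTM : Word → Set
IsFactorOfTM w = ∃ λ i → factorAt i (length w) ≡ w

IsPrefix : Word → Word → Set
IsPrefix u w = ∃ λ v → u ++ v ≡ w

IsSuffix : Word → Word → Set
IsSuffix u w = ∃ λ v → v ++ u ≡ w

_==_ : Bool → Bool → Bool
false == false = true
true  == true  = true
_     == _     = false

prefixOf? : Word → Word → Bool
prefixOf? []      _       = true
prefixOf? (a ∷ u) []      = false
prefixOf? (a ∷ u) (b ∷ w) = if a == b then prefixOf? u w else false

-- Number of occurrences of u in w (positions j with u a prefix of drop j w,
-- counting j = 0 … length w; for nonempty u the last position never matches).
occ : Word → Word → ℕ
occ u []      = if prefixOf? u [] then 1 else 0
occ u (b ∷ w) = (if prefixOf? u (b ∷ w) then 1 else 0) + occ u w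

CompleteFirstReturn : Word → Word → Set
CompleteFirstReturn u w = IsPrefix u w × IsSuffix u w × occ u w ≡ 2

data Privileged : Word → Set where
  priv-empty  : Privileged []
  priv-letter : (a : Bool) → Privileged (a ∷ [])
  priv-return : (u w : Word) → 2 ≤ length w → length u < length w →
                Privileged u → CompleteFirstReturn u w → Privileged w

module Submission where

-- Write t for the letters of the Thue–Morse word; they satisfy t(2j) = t(j) and
-- t(2j+1) = ¬t(j).  Call q a repeat if t(q) = t(q+1).  From the two recurrences:
--   * repeats occur only at odd positions, so t contains no three equal letters in a row;
--   * a factor of length 4 never occurs both at an even and at an odd position;
--   * between two consecutive repeats the letters alternate, which forces consecutive
--     repeats to carry different letters.
-- A privileged factor w of length n ≥ 5 is a complete first return to a shorter
-- privileged word u, occurring in w at offsets 0 and p = n - |u|.  We argue by strong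
-- induction on n and by the length of u:
--   |u| = 0     impossible, as ε occurs at every position;
--   |u| = 1     the ≥ 3 letters strictly inside w all differ from u, so they are equal;
--   |u| = 2     u = aa, both occurrences are repeats, so p is even and n is even;
--   |u| = 3     u = aba; halving positions turns the two occurrences of aba into
--               consecutive repeats with equal letters unless p is odd, so n is even;
--   |u| ≥ 4     both occurrences have equal parity, so p is even and |u| is odd,
--               and u is a shorter odd privileged factor of t, excluded by induction.

open import Defs
open import Data.Nat using (ℕ; _≤_; _+_; _*_)
open import Data.List using (length)
open import Data.Product using (_×_)
open import Relation.Nullary using (¬_)
open import Relation.Binary.PropositionalEquality using (_≡_)

open import Data.Bool using (Bool; true; false; not; _xor_)
open import Data.Bool.Properties
  using (_≟_; not-distribˡ-xor; xor-same; xor-identityʳ; xor-comm; not-injective; not-involutive; not-¬; ¬-not)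
open import Data.Nat using (zero; suc; _<_; z≤n; s≤s; pred; _∸_)
open import Data.Nat.Properties hiding (_≟_)
open import Data.Nat.Induction using (<-rec)
open import Data.Nat.Tactic.RingSolver using (solve-∀)
open import Data.List using ([]; _∷_; _++_; drop)
open import Data.List.Properties using (++-assoc; ++-identityʳ; length-++; ∷-injective; drop-drop)
open import Data.Product using (_,_; ∃; proj₁; proj₂)
open import Data.Sum using (_⊎_; inj₁; inj₂; [_,_])
open import Data.Empty using (⊥; ⊥-elim)
open import Relation.Nullary using (yes; no)
open import Relation.Binary.PropositionalEquality
  using (_≢_; refl; sym; trans; cong; cong₂; subst; module ≡-Reasoning)

t : ℕ → Bool
t = thueMorse

double-< : ∀ {j L} → j < L → suc (j + j) < L + L
double-< {j} {L} j<L = subst (_≤ L + L) (cong suc (+-suc j j)) (+-mono-≤ j<L j<L)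

double-suc : ∀ j → suc j + suc j ≡ suc (suc (j + j))
double-suc j = cong suc (+-suc j j)

double-+ : ∀ k j → (k + k) + (j + j) ≡ (k + j) + (k + j)
double-+ = solve-∀

odd : ℕ → Bool
odd zero    = false
odd (suc n) = not (odd n)

odd-+ : ∀ m n → odd (m + n) ≡ odd m xor odd n
odd-+ zero    n = refl
odd-+ (suc m) n = trans (cong not (odd-+ m n)) (not-distribˡ-xor (odd m) (odd n))

odd-double : ∀ j → odd (j + j) ≡ false
odd-double j = trans (odd-+ j j) (xor-same (odd j))

even-or-odd : ∀ n → ∃ λ j → n ≡ j + j ⊎ n ≡ suc (j + j)
even-or-odd zero = 0 , inj₁ refl
even-or-odd (suc n) with even-or-odd n
... | j , inj₁ refl = j , inj₂ refl
... | j , inj₂ refl = suc j , inj₁ (sym (double-suc j))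

xor-fixed⇒false : ∀ a b → a xor b ≡ b → a ≡ false
xor-fixed⇒false false b _  = refl
xor-fixed⇒false true  b eq = ⊥-elim (not-¬ refl (sym eq))

φ-cons : ∀ a w → φ (a ∷ w) ≡ a ∷ not a ∷ φ w
φ-cons false w = refl
φ-cons true  w = refl

φ-++ : ∀ u v → φ (u ++ v) ≡ φ u ++ φ v
φ-++ []      v = refl
φ-++ (a ∷ u) v = trans (cong (φ₁ a ++_) (φ-++ u v)) (sym (++-assoc (φ₁ a) (φ u) (φ v)))

φ^-++ : ∀ k u v → φ^ k (u ++ v) ≡ φ^ k u ++ φ^ k v
φ^-++ zero    u v = refl
φ^-++ (suc k) u v = trans (cong φ (φ^-++ k u v)) (φ-++ (φ^ k u) (φ^ k v))

φ^-suc : ∀ k w → φ^ (suc k) w ≡ φ^ k (φ w)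
φ^-suc zero    w = refl
φ^-suc (suc k) w = cong φ (φ^-suc k w)

length-φ : ∀ w → length (φ w) ≡ length w + length w
length-φ []      = refl
length-φ (a ∷ w) rewrite φ-cons a w | length-φ w = cong suc (sym (+-suc (length w) (length w)))

at-φ : ∀ w j → j < length w → at (φ w) (j + j) ≡ at w j × at (φ w) (suc (j + j)) ≡ not (at w j)
at-φ (a ∷ w) zero    _ rewrite φ-cons a w = refl , refl
at-φ (a ∷ w) (suc j) (s≤s j<|w|) rewrite φ-cons a w | +-suc j j = at-φ w j j<|w|

at-prefix : ∀ u v i → i < length u → at (u ++ v) i ≡ at u i
at-prefix (a ∷ u) v zero    _         = refl
at-prefix (a ∷ u) v (suc i) (s≤s i<n) = at-prefix u v i i<n

zeroWord : Word
zeroWord = false ∷ []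

-- φ^(k+1)(0) = φ^k(0) φ^k(1), so φ^k(0) is a prefix of every later iterate.
iterate-prefix : ∀ d k → IsPrefix (φ^ k zeroWord) (φ^ (d + k) zeroWord)
iterate-prefix zero    k = [] , ++-identityʳ _
iterate-prefix (suc d) k with iterate-prefix d k
... | v , eq = v ++ φ^ (d + k) one , (begin
  φ^ k zeroWord ++ (v ++ φ^ (d + k) one)   ≡⟨ sym (++-assoc (φ^ k zeroWord) v _) ⟩
  (φ^ k zeroWord ++ v) ++ φ^ (d + k) one   ≡⟨ cong (_++ φ^ (d + k) one) eq ⟩
  φ^ (d + k) zeroWord ++ φ^ (d + k) one    ≡⟨ sym (φ^-++ (d + k) zeroWord one) ⟩
  φ^ (d + k) (φ zeroWord)                  ≡⟨ sym (φ^-suc (d + k) zeroWord) ⟩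
  φ^ (suc d + k) zeroWord                  ∎)
  where
  open ≡-Reasoning
  one : Word
  one = true ∷ []

iterate-stable : ∀ d k i → i < length (φ^ k zeroWord) →
  at (φ^ (d + k) zeroWord) i ≡ at (φ^ k zeroWord) i
iterate-stable d k i i<n with iterate-prefix d k
... | v , eq = trans (cong (λ w → at w i) (sym eq)) (at-prefix (φ^ k zeroWord) v i i<n)

-- |φ^k(0)| = 2^k > k.
iterate-long : ∀ k → k < length (φ^ k zeroWord)
iterate-long zero    = s≤s z≤n
iterate-long (suc k) = subst (suc k <_) (sym (length-φ (φ^ k zeroWord)))
  (+-mono-≤ (≤-trans (s≤s z≤n) (iterate-long k)) (iterate-long k))

iterate-spells-t : ∀ k i → i < length (φ^ k zeroWord) → at (φ^ k zeroWord) i ≡ t i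
iterate-spells-t k i i<n with ≤-total k (suc i)
... | inj₁ k≤ with m≤n⇒∃[o]m+o≡n k≤
...   | d , k+d≡ = trans (sym (iterate-stable d k i i<n))
                         (cong (λ m → at (φ^ m zeroWord) i) (trans (+-comm d k) k+d≡))
iterate-spells-t k i i<n | inj₂ ≤k with m≤n⇒∃[o]m+o≡n ≤k
...   | d , i+d≡ = trans (cong (λ m → at (φ^ m zeroWord) i) (sym (trans (+-comm d (suc i)) i+d≡)))
                         (iterate-stable d (suc i) i (<-trans (n<1+n i) (iterate-long (suc i))))

-- t(2j) = t(j) and t(2j+1) = ¬t(j): both are read off φ(φ^(j+1)(0)) = φ^(j+2)(0).
t-doubling : ∀ j → t (j + j) ≡ t j × t (suc (j + j)) ≡ not (t j)
t-doubling j =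
    trans (sym (iterate-spells-t (suc (suc j)) (j + j) (<⇒≤ inside))) (proj₁ (at-φ w j j<|w|))
  , trans (sym (iterate-spells-t (suc (suc j)) (suc (j + j)) inside)) (proj₂ (at-φ w j j<|w|))
  where
  w : Word
  w = φ^ (suc j) zeroWord
  j<|w| : j < length w
  j<|w| = <-trans (n<1+n j) (iterate-long (suc j))
  inside : suc (j + j) < length (φ w)
  inside = subst (suc (j + j) <_) (sym (length-φ w)) (double-< j<|w|)

t-double : ∀ j → t (j + j) ≡ t j
t-double j = proj₁ (t-doubling j)

t-double+1 : ∀ j → t (suc (j + j)) ≡ not (t j)
t-double+1 j = proj₂ (t-doubling j)

t-double+2 : ∀ j → t (suc (suc (j + j))) ≡ t (suc j)
t-double+2 j = trans (cong t (sym (double-suc j))) (t-double (suc j))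

t-double+3 : ∀ j → t (suc (suc (suc (j + j)))) ≡ not (t (suc j))
t-double+3 j = trans (cong (λ m → t (suc m)) (sym (double-suc j))) (t-double+1 (suc j))

RepeatAt : ℕ → Set
RepeatAt q = t q ≡ t (suc q)

-- t(2j) ≠ t(2j+1), so repeats sit at odd positions.
repeat⇒odd : ∀ q → RepeatAt q → odd q ≡ true
repeat⇒odd q r with even-or-odd q
... | j , inj₁ refl = ⊥-elim (not-¬ refl (trans (sym (t-double j)) (trans r (t-double+1 j))))
... | j , inj₂ refl = cong not (odd-double j)

no-triple : ∀ q → RepeatAt q → RepeatAt (suc q) → ⊥
no-triple q r r′ = not-¬ refl (trans (sym (repeat⇒odd (suc q) r′)) (cong not (repeat⇒odd q r)))

repeat-distance-even : ∀ q d → RepeatAt q → RepeatAt (d + q) → odd d ≡ false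
repeat-distance-even q d r r′ = xor-fixed⇒false (odd d) (odd q)
  (trans (sym (odd-+ d q)) (trans (repeat⇒odd (d + q) r′) (sym (repeat⇒odd q r))))

alternate : ∀ s d → (∀ r → r < d → ¬ RepeatAt (s + r)) → t (s + d) ≡ odd d xor t s
alternate s zero    _    = cong t (+-identityʳ s)
alternate s (suc d) none = begin
  t (s + suc d)        ≡⟨ cong t (+-suc s d) ⟩
  t (suc (s + d))      ≡⟨ ¬-not (λ e → none d ≤-refl (sym e)) ⟩
  not (t (s + d))      ≡⟨ cong not (alternate s d (λ r r<d → none r (m<n⇒m<1+n r<d))) ⟩
  not (odd d xor t s)  ≡⟨ not-distribˡ-xor (odd d) (t s) ⟩
  odd (suc d) xor t s  ∎
  where open ≡-Reasoning

-- Consecutive repeats carry different letters: the distance between them is even and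
-- the letters in between alternate.
consecutive-repeats-differ : ∀ m m′ → m < m′ → RepeatAt m → RepeatAt m′ →
  (∀ q → m < q → q < m′ → ¬ RepeatAt q) → t m′ ≡ not (t m)
consecutive-repeats-differ m m′ m<m′ r r′ none with m≤n⇒∃[o]m+o≡n m<m′
... | d , refl = begin
  t (suc m + d)          ≡⟨ alternate (suc m) d (λ q q<d → none (suc m + q) (s≤s (m≤m+n m q)) (+-monoʳ-< (suc m) q<d)) ⟩
  odd d xor t (suc m)    ≡⟨ cong₂ _xor_ (not-injective odd-d) (sym r) ⟩
  true xor t m           ∎
  where
  open ≡-Reasoning
  odd-d : not (odd d) ≡ not true
  odd-d = repeat-distance-even m (suc d) r (subst RepeatAt (cong suc (+-comm m d)) r′)

OccursAt : Word → ℕ → Set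
OccursAt u q = factorAt q (length u) ≡ u

-- The factor of t of length p + |u| starting at i is a complete first return to u;
-- its two occurrences of u are at i and at p + i.
record FirstReturnAt (u : Word) (i p : ℕ) : Set where
  field
    starts : OccursAt u i
    ends   : OccursAt u (p + i)
    twice  : occ u (factorAt i (p + length u)) ≡ 2

open FirstReturnAt

length-factorAt : ∀ i n → length (factorAt i n) ≡ n
length-factorAt i zero    = refl
length-factorAt i (suc n) = cong suc (length-factorAt (suc i) n)

factor-length : ∀ {i n w} → factorAt i n ≡ w → n ≡ length w
factor-length {i} {n} F = trans (sym (length-factorAt i n)) (cong length F)

drop-factorAt : ∀ r i m → drop r (factorAt i (r + m)) ≡ factorAt (r + i) m
drop-factorAt zero    i m = refl
drop-factorAt (suc r) i m = trans (drop-factorAt r (suc i) m) (cong (λ q → factorAt q m) (+-suc r i))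

==-refl : ∀ a → (a == a) ≡ true
==-refl false = refl
==-refl true  = refl

prefixOf?-factorAt : ∀ q m e → prefixOf? (factorAt q m) (factorAt q (m + e)) ≡ true
prefixOf?-factorAt q zero    e = refl
prefixOf?-factorAt q (suc m) e rewrite ==-refl (t q) = prefixOf?-factorAt (suc q) m e

occurs⇒prefixOf? : ∀ u i n r → r + length u ≤ n → OccursAt u (r + i) →
  prefixOf? u (drop r (factorAt i n)) ≡ true
occurs⇒prefixOf? u i n r inside occurs with m≤n⇒∃[o]m+o≡n inside
... | e , refl rewrite +-assoc r (length u) e | drop-factorAt r i (length u + e) =
  subst (λ v → prefixOf? v (factorAt (r + i) (length u + e)) ≡ true) occurs
        (prefixOf?-factorAt (r + i) (length u) e)

occ-drop : ∀ u w d → occ u (drop d w) ≤ occ u w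
occ-drop u w       zero    = ≤-refl
occ-drop u []      (suc d) = ≤-refl
occ-drop u (b ∷ w) (suc d) = ≤-trans (occ-drop u w d) (m≤n+m _ _)

occ-head : ∀ c u v d → prefixOf? (c ∷ u) v ≡ true → suc (occ (c ∷ u) (drop (suc d) v)) ≤ occ (c ∷ u) v
occ-head c u (b ∷ v) d match rewrite match = s≤s (occ-drop (c ∷ u) v d)

occ-match : ∀ c u w r s → r < s → prefixOf? (c ∷ u) (drop r w) ≡ true →
  suc (occ (c ∷ u) (drop s w)) ≤ occ (c ∷ u) (drop r w)
occ-match c u w r s r<s match with m≤n⇒∃[o]m+o≡n r<s
... | d , refl = subst (λ v → suc (occ (c ∷ u) v) ≤ occ (c ∷ u) (drop r w))
  (trans (drop-drop r (suc d) w) (cong (λ m → drop m w) (+-suc r d)))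
  (occ-head c u (drop r w) d match)

no-inner-occurrence : ∀ {c u i p} → FirstReturnAt (c ∷ u) i p →
  ∀ q → i < q → q < p + i → ¬ OccursAt (c ∷ u) q
no-inner-occurrence {c} {u} {i} {p} R q i<q q<p+i occurs = <-irrefl refl (subst (3 ≤_) (twice R) three)
  where
  v : Word
  v = c ∷ u
  w : Word
  w = factorAt i (p + length v)
  r : ℕ
  r = q ∸ i
  r+i≡q : r + i ≡ q
  r+i≡q = m∸n+n≡m (<⇒≤ i<q)
  0<r : 0 < r
  0<r = +-cancelʳ-< i 0 r (subst (i <_) (sym r+i≡q) i<q)
  r<p : r < p
  r<p = +-cancelʳ-< i r p (subst (_< p + i) (sym r+i≡q) q<p+i)
  at-0 : prefixOf? v (drop 0 w) ≡ true
  at-0 = occurs⇒prefixOf? v i _ 0 (m≤n+m _ p) (starts R)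
  at-r : prefixOf? v (drop r w) ≡ true
  at-r = occurs⇒prefixOf? v i _ r (+-monoˡ-≤ (length v) (<⇒≤ r<p)) (subst (OccursAt v) (sym r+i≡q) occurs)
  at-p : prefixOf? v (drop p w) ≡ true
  at-p = occurs⇒prefixOf? v i _ p ≤-refl (ends R)
  three : 3 ≤ occ v w
  three = begin
    3                               ≤⟨ s≤s (s≤s (≤-trans (s≤s z≤n) (occ-match c u w p (suc p) ≤-refl at-p))) ⟩
    suc (suc (occ v (drop p w)))    ≤⟨ s≤s (occ-match c u w r p r<p at-r) ⟩
    suc (occ v (drop r w))          ≤⟨ occ-match c u w 0 r 0<r at-0 ⟩
    occ v w                         ∎
    where open ≤-Reasoning

occ-empty : ∀ w → occ [] w ≡ suc (length w)
occ-empty []      = refl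
occ-empty (b ∷ w) = cong suc (occ-empty w)

last-++ : ∀ v c u → at (v ++ c ∷ u) (pred (length (v ++ c ∷ u))) ≡ at (c ∷ u) (length u)
last-++ []           c u = refl
last-++ (b ∷ [])     c u = refl
last-++ (b ∷ b′ ∷ v) c u = last-++ (b′ ∷ v) c u

privileged-first≡last : ∀ {w} → Privileged w → at w 0 ≡ at w (pred (length w))
privileged-first≡last priv-empty       = refl
privileged-first≡last (priv-letter a)  = refl
privileged-first≡last (priv-return [] w 2≤|w| _ _ (_ , _ , twice′)) =
  ⊥-elim (<-irrefl (sym (suc-injective (trans (sym (occ-empty w)) twice′))) 2≤|w|)
privileged-first≡last (priv-return (c ∷ u) w _ _ pu ((v , pre) , (v′ , suf) , _)) = begin
  at w 0                              ≡⟨ cong (λ x → at x 0) (sym pre) ⟩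
  c                                   ≡⟨ privileged-first≡last pu ⟩
  at (c ∷ u) (length u)               ≡⟨ sym (last-++ v′ c u) ⟩
  at (v′ ++ c ∷ u) (pred (length (v′ ++ c ∷ u))) ≡⟨ cong (λ x → at x (pred (length x))) suf ⟩
  at w (pred (length w))              ∎
  where open ≡-Reasoning

prefix-occurs : ∀ u v i n → u ++ v ≡ factorAt i n → OccursAt u i
prefix-occurs []      v i n       eq = refl
prefix-occurs (a ∷ u) v i (suc n) eq with ∷-injective eq
... | refl , eq′ = cong (t i ∷_) (prefix-occurs u v (suc i) n eq′)

suffix-occurs : ∀ v u i n → v ++ u ≡ factorAt i n → OccursAt u (length v + i)
suffix-occurs []      u i n       refl = cong (factorAt i) (length-factorAt i n)
suffix-occurs (b ∷ v) u i (suc n) eq with ∷-injective eq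
... | _ , eq′ = subst (OccursAt u) (+-suc (length v) i) (suffix-occurs v u (suc i) n eq′)

record ReturnStructure (i n : ℕ) : Set where
  field
    u           : Word
    gap         : ℕ
    privileged  : Privileged u
    shorter     : length u < n
    total       : gap + length u ≡ n
    firstReturn : FirstReturnAt u i gap

decompose : ∀ i n w → 2 ≤ n → factorAt i n ≡ w → Privileged w → ReturnStructure i n
decompose i n w 2≤n F priv-empty      = ⊥-elim (<⇒≱ (subst (_< 2) (sym (factor-length F)) (s≤s z≤n)) 2≤n)
decompose i n w 2≤n F (priv-letter a) = ⊥-elim (<⇒≱ (subst (_< 2) (sym (factor-length F)) (s≤s (s≤s z≤n))) 2≤n)
decompose i n w 2≤n F (priv-return u w _ u<w pu ((v , pre) , (v′ , suf) , twice′)) = record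
  { u           = u
  ; gap         = length v′
  ; privileged  = pu
  ; shorter     = subst (length u <_) (sym (factor-length F)) u<w
  ; total       = total
  ; firstReturn = record
      { starts = prefix-occurs u v i n (trans pre (sym F))
      ; ends   = suffix-occurs v′ u i n (trans suf (sym F))
      ; twice  = subst (λ m → occ u (factorAt i m) ≡ 2) (sym total) (subst (λ x → occ u x ≡ 2) (sym F) twice′)
      }
  }
  where
  total : length v′ + length u ≡ n
  total = trans (sym (length-++ v′)) (trans (cong length suf) (sym (factor-length F)))

occurs₂ : ∀ {a b} q → OccursAt (a ∷ b ∷ []) q → t q ≡ a × t (suc q) ≡ b
occurs₂ q refl = refl , refl

occurs₃ : ∀ {a b c} q → OccursAt (a ∷ b ∷ c ∷ []) q → t q ≡ a × t (suc q) ≡ b × t (suc (suc q)) ≡ c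
occurs₃ q refl = refl , refl , refl

occurrence₃ : ∀ {a b c} q → t q ≡ a → t (suc q) ≡ b → t (suc (suc q)) ≡ c → OccursAt (a ∷ b ∷ c ∷ []) q
occurrence₃ q refl refl refl = refl

flip-not : ∀ {a b} → not a ≡ b → a ≡ not b
flip-not {a} refl = sym (not-involutive a)

-- The empty word occurs at every position, so its complete first returns have length 1.
empty-return : ∀ {i p} → FirstReturnAt [] i p → p ≡ 1
empty-return {i} {p} R = begin
  p                                   ≡⟨ sym (+-identityʳ p) ⟩
  p + 0                               ≡⟨ suc-injective (begin
    suc (p + 0)                         ≡⟨ cong suc (sym (length-factorAt i (p + 0))) ⟩
    suc (length (factorAt i (p + 0)))   ≡⟨ sym (occ-empty (factorAt i (p + 0))) ⟩
    occ [] (factorAt i (p + 0))         ≡⟨ twice R ⟩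
    2                                   ∎) ⟩
  1                                   ∎
  where open ≡-Reasoning

-- The letters strictly inside a complete first return to a letter a differ from a;
-- with a gap of at least 4 there would be three equal letters in a row.
letter-return-short : ∀ {a i p} → FirstReturnAt (a ∷ []) i p → 4 ≤ p → ⊥
letter-return-short {a} {i} {p} R 4≤p = no-triple (suc i)
  (trans (inside 1 (s≤s z≤n) (≤-trans (s≤s (s≤s z≤n)) 4≤p)) (sym (inside 2 (s≤s z≤n) 3≤p)))
  (trans (inside 2 (s≤s z≤n) 3≤p) (sym (inside 3 (s≤s z≤n) 4≤p)))
  where
  3≤p : 3 ≤ p
  3≤p = ≤-trans (n≤1+n 3) 4≤p
  inside : ∀ r → 0 < r → r < p → t (r + i) ≡ not a
  inside r 0<r r<p = ¬-not (λ e → no-inner-occurrence R (r + i) (m<n+m i 0<r) (+-monoˡ-< i r<p) (cong (_∷ []) e))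

-- A privileged word of length 2 is a square aa; its occurrences are repeats, so the
-- gap of a return to it is even.
square-return-even : ∀ {a b i p} → Privileged (a ∷ b ∷ []) → FirstReturnAt (a ∷ b ∷ []) i p → odd p ≡ false
square-return-even {a} {b} {i} {p} pu R = repeat-distance-even i p (repeat i (starts R)) (repeat (p + i) (ends R))
  where
  repeat : ∀ q → OccursAt (a ∷ b ∷ []) q → RepeatAt q
  repeat q occurs = trans (proj₁ (occurs₂ q occurs)) (trans (privileged-first≡last pu) (sym (proj₂ (occurs₂ q occurs))))

aba : Bool → Word
aba x = x ∷ not x ∷ x ∷ []

aba-at-even : ∀ x j → OccursAt (aba x) (j + j) → RepeatAt j × t j ≡ x
aba-at-even x j occurs = trans tj (sym tj+1) , tj
  where
  tj : t j ≡ x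
  tj = trans (sym (t-double j)) (proj₁ (occurs₃ (j + j) occurs))
  tj+1 : t (suc j) ≡ x
  tj+1 = trans (sym (t-double+2 j)) (proj₂ (proj₂ (occurs₃ (j + j) occurs)))

aba-at-odd : ∀ x j → OccursAt (aba x) (suc (j + j)) → RepeatAt j × t j ≡ not x
aba-at-odd x j occurs = trans tj (sym tj+1) , tj
  where
  tj : t j ≡ not x
  tj = flip-not (trans (sym (t-double+1 j)) (proj₁ (occurs₃ (suc (j + j)) occurs)))
  tj+1 : t (suc j) ≡ not x
  tj+1 = flip-not (trans (sym (t-double+3 j)) (proj₂ (proj₂ (occurs₃ (suc (j + j)) occurs))))

repeat⇒aba : ∀ x q → RepeatAt q → OccursAt (aba x) (q + q) ⊎ OccursAt (aba x) (suc (q + q))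
repeat⇒aba x q r with t q ≟ x
... | yes tq≡x = inj₁ (occurrence₃ (q + q)
  (trans (t-double q) tq≡x)
  (trans (t-double+1 q) (cong not tq≡x))
  (trans (t-double+2 q) (trans (sym r) tq≡x)))
... | no tq≢x = inj₂ (occurrence₃ (suc (q + q))
  (trans (t-double+1 q) (trans (cong not tq≡¬x) (not-involutive x)))
  (trans (t-double+2 q) (trans (sym r) tq≡¬x))
  (trans (t-double+3 q) (trans (cong not (trans (sym r) tq≡¬x)) (not-involutive x))))
  where
  tq≡¬x : t q ≡ not x
  tq≡¬x = ¬-not tq≢x

-- If the two occurrences of aba bounding a complete first return lie over repeats at
-- j < j′ (with i ≤ 2j + 1 and 2j′ ≤ p + i), every repeat strictly between them would
-- give an inner occurrence of aba; so they are consecutive and carry different letters.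
aba-return-over-repeats : ∀ {x i p} → FirstReturnAt (aba x) i p → ∀ j j′ → j < j′ →
  i ≤ suc (j + j) → j′ + j′ ≤ p + i → RepeatAt j → RepeatAt j′ → t j ≢ t j′
aba-return-over-repeats {x} {i} {p} R j j′ j<j′ lo hi r r′ same =
  not-¬ refl (trans same (consecutive-repeats-differ j j′ j<j′ r r′ inner))
  where
  inner : ∀ q → j < q → q < j′ → ¬ RepeatAt q
  inner q j<q q<j′ rq = [ no-inner-occurrence R (q + q) above (<-trans (n<1+n _) below)
                        , no-inner-occurrence R (suc (q + q)) (<-trans above (n<1+n _)) below
                        ] (repeat⇒aba x q rq)
    where
    above : i < q + q
    above = ≤-<-trans lo (double-< j<q)
    below : suc (q + q) < p + i
    below = <-≤-trans (double-< q<j′) hi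

-- A complete first return to aba has an odd gap.  If the gap 2k were even, halving the
-- positions of the two occurrences gives repeats at j and k + j with equal letters.
aba-return-odd : ∀ {x i p} → 0 < p → FirstReturnAt (aba x) i p → odd p ≡ true
aba-return-odd {x} {i} {p} 0<p R with even-or-odd p
... | k , inj₂ refl = cong not (odd-double k)
... | zero , inj₁ refl = ⊥-elim (<-irrefl refl 0<p)
... | suc k , inj₁ refl with even-or-odd i
...   | j , inj₁ refl = ⊥-elim (aba-return-over-repeats R j (K + j) j<K+j (n≤1+n _) (≤-reflexive (sym shift))
                          (proj₁ first) (proj₁ second) (trans (proj₂ first) (sym (proj₂ second))))
  where
  K : ℕ
  K = suc k
  j<K+j : j < K + j
  j<K+j = m<n+m j (s≤s z≤n)
  shift : (K + K) + (j + j) ≡ (K + j) + (K + j)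
  shift = double-+ K j
  first : RepeatAt j × t j ≡ x
  first = aba-at-even x j (starts R)
  second : RepeatAt (K + j) × t (K + j) ≡ x
  second = aba-at-even x (K + j) (subst (OccursAt (aba x)) shift (ends R))
...   | j , inj₂ refl = ⊥-elim (aba-return-over-repeats R j (K + j) j<K+j ≤-refl (≤-trans (n≤1+n _) (≤-reflexive (sym shift)))
                          (proj₁ first) (proj₁ second) (trans (proj₂ first) (sym (proj₂ second))))
  where
  K : ℕ
  K = suc k
  j<K+j : j < K + j
  j<K+j = m<n+m j (s≤s z≤n)
  shift : (K + K) + suc (j + j) ≡ suc ((K + j) + (K + j))
  shift = trans (+-suc (K + K) (j + j)) (cong suc (double-+ K j))
  first : RepeatAt j × t j ≡ not x
  first = aba-at-odd x j (starts R)
  second : RepeatAt (K + j) × t (K + j) ≡ not x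
  second = aba-at-odd x (K + j) (subst (OccursAt (aba x)) shift (ends R))

-- A privileged word of length 3 is aba (aaa does not occur in t), so a return to it
-- has an odd gap.
triple-return-odd : ∀ {a b c i p} → 0 < p → Privileged (a ∷ b ∷ c ∷ []) → FirstReturnAt (a ∷ b ∷ c ∷ []) i p →
  odd p ≡ true
triple-return-odd {a} {b} {c} {i} 0<p pu R with privileged-first≡last pu | a ≟ b
... | refl | yes refl = ⊥-elim (no-triple i (trans ta (sym tb)) (trans tb (sym tc)))
  where
  letters : t i ≡ a × t (suc i) ≡ a × t (suc (suc i)) ≡ a
  letters = occurs₃ i (starts R)
  ta : t i ≡ a
  ta = proj₁ letters
  tb : t (suc i) ≡ a
  tb = proj₁ (proj₂ letters)
  tc : t (suc (suc i)) ≡ a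
  tc = proj₂ (proj₂ letters)
... | refl | no a≢b with ¬-not (λ e → a≢b (sym e))
...   | refl = aba-return-odd 0<p R

-- A factor of length 4 cannot occur both at an even position 2a, where it reads
-- t(a) ¬t(a) t(a+1) ¬t(a+1), and at an odd position 2b + 1, where it reads
-- ¬t(b) t(b+1) ¬t(b+1) t(b+2): matching the two forces t(b) = t(b+1) = t(b+2).
even-odd-clash : ∀ a b m → factorAt (a + a) (4 + m) ≡ factorAt (suc (b + b)) (4 + m) → ⊥
even-odd-clash a b m F = no-triple b (proj₁ forced) (proj₂ forced)
  where
  -- the letters read as A ¬A A₁ ¬A₁ and as ¬B B₁ ¬B₁ B₂
  forced-letters : ∀ {A A₁ B B₁ B₂} → A ≡ not B → not A ≡ B₁ → A₁ ≡ not B₁ → not A₁ ≡ B₂ →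
    B ≡ B₁ × B₁ ≡ B₂
  forced-letters {B = false} refl refl refl refl = refl , refl
  forced-letters {B = true}  refl refl refl refl = refl , refl
  F₁ : factorAt (suc (a + a)) (3 + m) ≡ factorAt (suc (suc (b + b))) (3 + m)
  F₁ = proj₂ (∷-injective F)
  F₂ : factorAt (suc (suc (a + a))) (2 + m) ≡ factorAt (suc (suc (suc (b + b)))) (2 + m)
  F₂ = proj₂ (∷-injective F₁)
  F₃ : factorAt (suc (suc (suc (a + a)))) (1 + m) ≡ factorAt (suc (suc (suc (suc (b + b))))) (1 + m)
  F₃ = proj₂ (∷-injective F₂)
  forced : RepeatAt b × RepeatAt (suc b)
  forced = forced-letters
    (trans (sym (t-double a))   (trans (proj₁ (∷-injective F))  (t-double+1 b)))
    (trans (sym (t-double+1 a)) (trans (proj₁ (∷-injective F₁)) (t-double+2 b)))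
    (trans (sym (t-double+2 a)) (trans (proj₁ (∷-injective F₂)) (t-double+3 b)))
    (trans (sym (t-double+3 a)) (trans (proj₁ (∷-injective F₃))
      (trans (cong (λ m → t (suc (suc m))) (sym (double-suc b))) (t-double+2 (suc b)))))

synchronised : ∀ m i j → factorAt i (4 + m) ≡ factorAt j (4 + m) → odd i ≡ odd j
synchronised m i j F with even-or-odd i | even-or-odd j
... | a , inj₁ refl | b , inj₁ refl = trans (odd-double a) (sym (odd-double b))
... | a , inj₂ refl | b , inj₂ refl = cong not (trans (odd-double a) (sym (odd-double b)))
... | a , inj₁ refl | b , inj₂ refl = ⊥-elim (even-odd-clash a b m F)
... | a , inj₂ refl | b , inj₁ refl = ⊥-elim (even-odd-clash b a m (sym F))

NoOddPrivileged : ℕ → Set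
NoOddPrivileged n = 5 ≤ n → odd n ≡ true → ∀ i w → factorAt i n ≡ w → ¬ Privileged w

return-impossible : ∀ u i p → 5 ≤ p + length u → odd (p + length u) ≡ true →
  (∀ {m} → m < p + length u → NoOddPrivileged m) → length u < p + length u →
  Privileged u → FirstReturnAt u i p → ⊥
return-impossible [] i p long _ _ _ _ R =
  <⇒≱ (s≤s (s≤s z≤n)) (subst (λ g → 5 ≤ g + 0) (empty-return R) long)
return-impossible (a ∷ []) i p long _ _ _ _ R =
  letter-return-short R (+-cancelʳ-≤ 1 4 p long)
return-impossible (a ∷ b ∷ []) i p _ odd-n _ _ pu R = not-¬ refl (begin
  false              ≡⟨ sym (square-return-even pu R) ⟩
  odd p              ≡⟨ sym (xor-identityʳ (odd p)) ⟩
  odd p xor false    ≡⟨ sym (odd-+ p 2) ⟩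
  odd (p + 2)        ≡⟨ odd-n ⟩
  true               ∎)
  where open ≡-Reasoning
return-impossible (a ∷ b ∷ c ∷ []) i p long odd-n _ _ pu R = not-¬ refl (begin
  false              ≡⟨ cong not (sym (triple-return-odd 0<p pu R)) ⟩
  not (odd p)        ≡⟨ xor-comm true (odd p) ⟩
  odd p xor true     ≡⟨ sym (odd-+ p 3) ⟩
  odd (p + 3)        ≡⟨ odd-n ⟩
  true               ∎)
  where
  open ≡-Reasoning
  0<p : 0 < p
  0<p = ≤-trans (s≤s z≤n) (+-cancelʳ-≤ 3 2 p long)
return-impossible (a ∷ b ∷ c ∷ d ∷ v) i p _ odd-n IH shorter pu R =
  IH shorter (five≤ v odd-u) odd-u i u (starts R) pu
  where
  u : Word
  u = a ∷ b ∷ c ∷ d ∷ v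
  -- both occurrences of u have the same parity, so the gap is even
  even-gap : odd p ≡ false
  even-gap = xor-fixed⇒false (odd p) (odd i)
    (trans (sym (odd-+ p i)) (sym (synchronised (length v) i (p + i) (trans (starts R) (sym (ends R))))))
  odd-u : odd (length u) ≡ true
  odd-u = trans (cong (_xor odd (length u)) (sym even-gap)) (trans (sym (odd-+ p (length u))) odd-n)
  five≤ : ∀ v → odd (4 + length v) ≡ true → 5 ≤ 4 + length v
  five≤ []      ()
  five≤ (_ ∷ _) _ = s≤s (s≤s (s≤s (s≤s (s≤s z≤n))))

no-odd-privileged : ∀ n → NoOddPrivileged n
no-odd-privileged = <-rec NoOddPrivileged step
  where
  step : ∀ n → (∀ {m} → m < n → NoOddPrivileged m) → NoOddPrivileged n
  step n IH long odd-n i w F pw =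
    return-impossible u i gap (≡⇒ (5 ≤_) long) (≡⇒ (λ m → odd m ≡ true) odd-n)
      (λ {m} m<total → IH (subst (m <_) total m<total)) (≡⇒ (length u <_) shorter) privileged firstReturn
    where
    open ReturnStructure (decompose i n w (≤-trans (s≤s (s≤s z≤n)) long) F pw)
    ≡⇒ : ∀ (P : ℕ → Set) → P n → P (gap + length u)
    ≡⇒ P = subst P (sym total)

mainTheorem19 : (n : ℕ) → 5 ≤ n → (k : ℕ) → n ≡ 2 * k + 1 →
    (w : Word) → IsFactorOfTM w → length w ≡ n → ¬ Privileged w
mainTheorem19 n 5≤n k n≡2k+1 w (i , F) |w|≡n =
  no-odd-privileged n 5≤n odd-n i w (subst (λ m → factorAt i m ≡ w) |w|≡n F)
  where
  odd-n : odd n ≡ true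
  odd-n = begin
    odd n                       ≡⟨ cong odd n≡2k+1 ⟩
    odd (2 * k + 1)             ≡⟨ odd-+ (2 * k) 1 ⟩
    odd (k + (k + 0)) xor true  ≡⟨ cong (λ m → odd (k + m) xor true) (+-identityʳ k) ⟩
    odd (k + k) xor true        ≡⟨ cong (_xor true) (odd-double k) ⟩
    true                        ∎
    where open ≡-Reasoning
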